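{- Let $(W,S)$ be a simply-laced triangle-free Coxeter system. If ${\boldsymbol{\varphi}}$ is a Fibonacci link of rank $r\ge0$, then $|[{\boldsymbol{\varphi}}]|=F_{r+2}$, where $F_1=F_2=1$ and $F_n=F_{n-1}+F_{n-2}$.
   Context: A Coxeter system $(W,S)$: finite $S$, $W=\langle S\mid (st)^{m(s,t)}=e\rangle$, $m(s,s)=1$, $m(s,t)\in\{2,3,\dots,\infty\}$ for $s\ne t$; simply laced: $m(s,t)\le3$; Coxeter graph $\Gamma$ on $S$ with edge $\{s,t\}$ iff $m(s,t)\ge3$; triangle free: no three-cycles in $\Gamma$. Reduced expression: minimal-length word for its element. Braid move: replace consecutive $sts$ by $tst$ with $m(s,t)=3$; braid class $[{\boldsymbol{\alpha}}]$: reduced expressions reachable from ${\boldsymbol{\alpha}}$ by braid moves. For ${\boldsymbol{\alpha}}=s_{x_1}\cdots s_{x_m}$, $\llbracket i,i+2\rrbracket$ is a braid shadow if $s_{x_i}=s_{x_{i+2}}$ and $m(s_{x_i},s_{x_{i+1}})=3$; $\operatorname{bs}({\boldsymbol{\alpha}})$ is the set of braid shadows, $\operatorname{bs}([{\boldsymbol{\alpha}}])$ the union over the braid class, $\operatorname{rank}({\boldsymbol{\alpha}})=|\operatorname{bs}([{\boldsymbol{\alpha}}])|$. A reduced expression with $m\ge1$ letters is a link if $m=1$ or $m$ is odd and $\operatorname{bs}([{\boldsymbol{\alpha}}])=\{\llbracket1,3\rrbracket,\dots,\llbracket m-2,m\rrbracket\}$. A Fibonacci link is a link ${\boldsymbol{\varphi}}$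 with $\operatorname{bs}([{\boldsymbol{\varphi}}])=\operatorname{bs}({\boldsymbol{\varphi}})$. -}

module Defs where

open import Data.Nat using (ℕ; zero; suc; _+_; _≤_)
open import Data.Nat.Properties using ()
open import Data.Fin using (Fin)
open import Data.List using (List; []; _∷_; _++_; length; replicate; concat)
open import Data.List.Relation.Unary.Unique.Propositional using (Unique)
open import Data.List.Membership.Propositional using (_∈_)
open import Data.Product using (Σ; ∃; ∃-syntax; _×_; _,_)
open import Data.Sum using (_⊎_)
open import Data.Empty using (⊥)
open import Relation.Nullary using (¬_)
open import Relation.Binary.PropositionalEquality using (_≡_; _≢_)
open import Relation.Binary.Construct.Closure.Equivalence using (EqClosure)
open import Relation.Binary.Construct.Closure.ReflexiveTransitive using (Star)
open import Function.Bundles using (_⇔_)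

data Entry : Set where
  fin : ℕ → Entry
  ∞   : Entry

record CoxeterMatrix (n : ℕ) : Set where
  field
    m      : Fin n → Fin n → Entry
    diag   : ∀ s → m s s ≡ fin 1
    sym    : ∀ s t → m s t ≡ m t s
    offdiag : ∀ s t → s ≢ t → (m s t ≡ ∞) ⊎ (∃[ k ] (m s t ≡ fin k × 2 ≤ k))
open CoxeterMatrix public

Word : ℕ → Set
Word n = List (Fin n)

module _ {n : ℕ} (M : CoxeterMatrix n) where

  -- Defining relators (st)^{m(s,t)} for finite m(s,t) (for s = t this is s s).
  data Relator : Word n → Set where
    rel : ∀ s t k → m M s t ≡ fin k → Relator (concat (replicate k (s ∷ t ∷ [])))

  data InsRel : Word n → Word n → Set where
    ins : ∀ u r v → Relator r → InsRel (u ++ v) (u ++ r ++ v)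

  -- Two words represent the same element of W = ⟨S | (st)^{m(s,t)} = e⟩
  -- (all generators are involutions, so words over S represent all of W).
  _≈W_ : Word n → Word n → Set
  _≈W_ = EqClosure InsRel

  Reduced : Word n → Set
  Reduced α = ∀ β → α ≈W β → length α ≤ length β

  Edge : Fin n → Fin n → Set
  Edge s t = s ≢ t × ((m M s t ≡ ∞) ⊎ (∃[ k ] (m M s t ≡ fin k × 3 ≤ k)))

  SimplyLaced : Set
  SimplyLaced = ∀ s t → s ≢ t → ∃[ k ] (m M s t ≡ fin k × k ≤ 3)

  TriangleFree : Set
  TriangleFree = ∀ s t u → ¬ (Edge s t × Edge t u × Edge u s)

  data BraidMove : Word n → Word n → Set where
    move : ∀ u s t v → m M s t ≡ fin 3 →
           BraidMove (u ++ s ∷ t ∷ s ∷ v) (u ++ t ∷ s ∷ t ∷ v)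

  InBraidClass : Word n → Word n → Set
  InBraidClass α β = Star BraidMove α β

  -- Braid shadows are indexed by their (0-based) starting position i;
  -- the 0-based index i corresponds to the paper's ⟦i+1, i+3⟧.
  IsShadow : Word n → ℕ → Set
  IsShadow α i = ∃[ u ] ∃[ s ] ∃[ t ] ∃[ v ]
    (α ≡ u ++ s ∷ t ∷ s ∷ v × length u ≡ i × m M s t ≡ fin 3)

  InBsClass : Word n → ℕ → Set
  InBsClass α i = ∃[ β ] (InBraidClass α β × IsShadow β i)

  HasRank : Word n → ℕ → Set
  HasRank α r = ∃[ L ] (Unique L × (∀ i → (i ∈ L) ⇔ InBsClass α i) × length L ≡ r)

  BraidClassSize : Word n → ℕ → Set
  BraidClassSize α c = ∃[ L ] (Unique L × (∀ β → (β ∈ L) ⇔ InBraidClass α β) × length L ≡ c)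

  Odd : ℕ → Set
  Odd k = ∃[ j ] (k ≡ suc (j + j))

  Even : ℕ → Set
  Even k = ∃[ j ] (k ≡ j + j)

  -- Link: reduced, m ≥ 1 letters, and either m = 1 or m odd with
  -- bs([α]) = {⟦1,3⟧, ⟦3,5⟧, …, ⟦m-2,m⟧}  (0-based starts: even i with i+3 ≤ m).
  IsLink : Word n → Set
  IsLink α = Reduced α × 1 ≤ length α ×
    ((length α ≡ 1) ⊎
     (Odd (length α) × (∀ i → InBsClass α i ⇔ (Even i × i + 3 ≤ length α))))

  IsFibonacciLink : Word n → Set
  IsFibonacciLink φ = IsLink φ × (∀ i → InBsClass φ i ⇔ IsShadow φ i)

F : ℕ → ℕ
F zero = zero
F (suc zero) = suc zero
F (suc (suc k)) = F (suc k) + F k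

-- A Fibonacci link of rank k is a zigzag a b₁ a b₂ ⋯ a bₖ a with m(a,bᵢ) = 3 whose class
-- has braid shadows only at even positions.  So every braid move flips a triple
-- a bᵢ a ↔ bᵢ a bᵢ; overlapping triples cannot both be flipped, and triangle-freeness
-- forbids a move on the triple bᵢ₋₁ bᵢ bᵢ₊₁ left between two flipped ones.  The class is
-- therefore indexed by the sets of pairwise non-adjacent triples among k in a row, of
-- which there are F(k+2), while the shadows at the k even positions give rank k.

module Submission where

open import Defs hiding (sym)
open import Data.Nat using (ℕ; zero; suc; _+_; _≤_; _<_; z≤n; s≤s)
open import Data.Nat.Properties
  using (suc-injective; +-suc; +-comm; ≤-refl; ≤-reflexive; ≤-trans; ≤-pred; <⇒≢; <⇒≱; ≮⇒≥;
         +-mono-≤; +-mono-<; +-monoʳ-≤; m≤m+n; m+n≤o⇒n≤o)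
open import Data.Fin using (Fin)
open import Data.List using (List; []; _∷_; _++_; length; map; applyUpTo)
open import Data.List.Properties using (length-++; length-map; length-applyUpTo; ∷-injectiveˡ; ∷-injectiveʳ)
open import Data.List.Membership.Propositional using (_∈_)
open import Data.List.Membership.Propositional.Properties
  using (∈-++⁻; ∈-++⁺ˡ; ∈-++⁺ʳ; ∈-map⁻; ∈-map⁺; ∈-applyUpTo⁻; ∈-applyUpTo⁺)
open import Data.List.Membership.Propositional.Properties.WithK using (unique∧set⇒bag)
open import Data.List.Relation.Unary.Any using (here; there)
open import Data.List.Relation.Unary.All using (All; []; _∷_)
open import Data.List.Relation.Unary.AllPairs using ([]; _∷_)
open import Data.List.Relation.Unary.Unique.Propositional using (Unique)
import Data.List.Relation.Unary.Unique.Propositional.Properties as Unique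
open import Data.List.Relation.Binary.Disjoint.Propositional using (Disjoint)
open import Data.List.Relation.Binary.BagAndSetEquality using (∼bag⇒↭)
open import Data.List.Relation.Binary.Permutation.Propositional.Properties using (↭-length)
open import Data.Product using (∃; ∃₂; _×_; _,_; proj₁; proj₂)
open import Data.Sum using (inj₁; inj₂)
open import Data.Empty using (⊥; ⊥-elim)
open import Function using (_∘_)
open import Function.Bundles using (_⇔_; mk⇔; Equivalence)
import Function.Properties.Equivalence as ⇔
open import Relation.Nullary using (¬_)
open import Relation.Binary.PropositionalEquality
  using (_≡_; _≢_; refl; sym; trans; cong; cong₂; subst; module ≡-Reasoning)
open import Relation.Binary.Construct.Closure.ReflexiveTransitive using (ε; _◅_)

open Equivalence using (to; from)

unique∧set⇒length≡ : ∀ {A : Set} {xs ys : List A} → Unique xs → Unique ys →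
                     (∀ x → x ∈ xs ⇔ x ∈ ys) → length xs ≡ length ys
unique∧set⇒length≡ xs! ys! xs⇔ys = ↭-length (∼bag⇒↭ (unique∧set⇒bag xs! ys! (λ {x} → xs⇔ys x)))

m+m≤n+n⇒m≤n : ∀ {m n} → m + m ≤ n + n → m ≤ n
m+m≤n+n⇒m≤n m+m≤n+n = ≮⇒≥ (λ n<m → <⇒≱ (+-mono-< n<m n<m) m+m≤n+n)

double+3≡ : ∀ j → j + j + 3 ≡ suc (suc j + suc j)
double+3≡ j = trans (+-comm (j + j) 3) (cong (suc ∘ suc) (sym (+-suc j j)))

<⇔double+3≤ : ∀ {j k} → j < k ⇔ j + j + 3 ≤ suc (k + k)
<⇔double+3≤ {j} {k} = mk⇔
  (λ j<k → ≤-trans (≤-reflexive (double+3≡ j)) (s≤s (+-mono-≤ j<k j<k)))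
  (λ bound → m+m≤n+n⇒m≤n (≤-pred (≤-trans (≤-reflexive (sym (double+3≡ j))) bound)))

¬i+3≤1 : ∀ i → ¬ i + 3 ≤ 1
¬i+3≤1 i i+3≤1 with m+n≤o⇒n≤o i i+3≤1
... | s≤s ()

data EvenLength {A : Set} : List A → Set where
  even-[] : EvenLength []
  even-∷∷ : ∀ {x y xs} → EvenLength xs → EvenLength (x ∷ y ∷ xs)

cons₂ : ∀ {A : Set} → A → A → List A → List A
cons₂ x y xs = x ∷ y ∷ xs

cons₂-injective : ∀ {A : Set} {x y : A} {xs ys} → cons₂ x y xs ≡ cons₂ x y ys → xs ≡ ys
cons₂-injective = ∷-injectiveʳ ∘ ∷-injectiveʳ

zigzagTail : ∀ {n} → Fin n → List (Fin n) → Word n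
zigzagTail a [] = []
zigzagTail a (b ∷ bs) = b ∷ a ∷ zigzagTail a bs

zigzag : ∀ {n} → Fin n → List (Fin n) → Word n
zigzag a bs = a ∷ zigzagTail a bs

module _ {n : ℕ} (M : CoxeterMatrix n) where

  Even-2+⁺ : ∀ {i} → Even M i → Even M (2 + i)
  Even-2+⁺ (j , refl) = suc j , cong suc (sym (+-suc j j))

  Even-2+⁻ : ∀ {i} → Even M (2 + i) → Even M i
  Even-2+⁻ (zero , ())
  Even-2+⁻ (suc j , eq) = j , suc-injective (trans (suc-injective eq) (+-suc j j))

  ¬Even-1 : ¬ Even M 1
  ¬Even-1 (zero , ())
  ¬Even-1 (suc j , eq) with trans (suc-injective eq) (+-suc j j)
  ... | ()

  Even⇒EvenLength : ∀ {A : Set} (xs : List A) → Even M (length xs) → EvenLength xs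
  Even⇒EvenLength [] _ = even-[]
  Even⇒EvenLength (_ ∷ []) even = ⊥-elim (¬Even-1 even)
  Even⇒EvenLength (_ ∷ _ ∷ xs) even = even-∷∷ (Even⇒EvenLength xs (Even-2+⁻ even))

  evenStarts : ℕ → List ℕ
  evenStarts = applyUpTo (λ j → j + j)

  evenStarts-unique : ∀ k → Unique (evenStarts k)
  evenStarts-unique k = Unique.applyUpTo⁺₁ _ k (λ i<j _ → <⇒≢ (+-mono-< i<j i<j))

  ∈-evenStarts : ∀ {i k} → i ∈ evenStarts k ⇔ (Even M i × i + 3 ≤ suc (k + k))
  ∈-evenStarts {i} {k} = mk⇔ to′ from′
    where
    to′ : i ∈ evenStarts k → Even M i × i + 3 ≤ suc (k + k)
    to′ i∈ with j , j<k , refl ← ∈-applyUpTo⁻ _ i∈ = (j , refl) , to <⇔double+3≤ j<k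
    from′ : Even M i × i + 3 ≤ suc (k + k) → i ∈ evenStarts k
    from′ ((j , refl) , bound) = ∈-applyUpTo⁺ (λ j → j + j) (from (<⇔double+3≤ {j}) bound)

  m≡3⇒≢ : ∀ {s t} → m M s t ≡ fin 3 → s ≢ t
  m≡3⇒≢ {s} m≡3 refl with trans (sym (diag M s)) m≡3
  ... | ()

  m≡3⇒Edge : ∀ {s t} → m M s t ≡ fin 3 → Edge M s t
  m≡3⇒Edge m≡3 = m≡3⇒≢ m≡3 , inj₂ (3 , m≡3 , ≤-refl)

  ∷-braids : ∀ x {w w′} → InBraidClass M w w′ → InBraidClass M (x ∷ w) (x ∷ w′)
  ∷-braids x ε = ε
  ∷-braids x (move u s t v m≡3 ◅ w→w′) = move (x ∷ u) s t v m≡3 ◅ ∷-braids x w→w′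

  IsShadow⇒+3≤length : ∀ {w i} → IsShadow M w i → i + 3 ≤ length w
  IsShadow⇒+3≤length (u , s , t , v , refl , refl , _) =
    ≤-trans (+-monoʳ-≤ (length u) (m≤m+n 3 (length v))) (≤-reflexive (sym (length-++ u)))

  IsShadow-∷⁻ : ∀ {x w i} → IsShadow M (x ∷ w) (suc i) → IsShadow M w i
  IsShadow-∷⁻ (_ ∷ u , s , t , v , refl , refl , m≡3) = u , s , t , v , refl , refl , m≡3

  IsShadow-0⁻ : ∀ {x y z v} → IsShadow M (x ∷ y ∷ z ∷ v) 0 → x ≡ z × m M x y ≡ fin 3
  IsShadow-0⁻ ([] , _ , _ , _ , refl , _ , m≡3) = refl , m≡3

  BraidsWith : Fin n → List (Fin n) → Set
  BraidsWith a = All (λ b → m M a b ≡ fin 3)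

  ZigzagShape : ℕ → Word n → Set
  ZigzagShape k w = ∃₂ λ a bs → w ≡ zigzag a bs × length bs ≡ k × BraidsWith a bs

  zigzagShape : ∀ k w → length w ≡ suc (k + k) →
                (∀ i → Even M i → i + 3 ≤ length w → IsShadow M w i) → ZigzagShape k w
  zigzagShape zero (x ∷ []) _ _ = x , [] , refl , refl , []
  zigzagShape (suc k) (x ∷ y ∷ w) length≡ shadows
    with a , bs , refl , length-bs , braids ←
           zigzagShape k w (trans (suc-injective (suc-injective length≡)) (+-suc k k))
             (λ i even bound → IsShadow-∷⁻ (IsShadow-∷⁻ (shadows (2 + i) (Even-2+⁺ even) (s≤s (s≤s bound)))))
    with refl , xy ← IsShadow-0⁻ (shadows 0 (0 , refl) (s≤s (s≤s (s≤s z≤n))))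
    = a , y ∷ bs , refl , cong suc length-bs , xy ∷ braids
  zigzagShape zero [] ()
  zigzagShape zero (_ ∷ _ ∷ _) ()
  zigzagShape (suc k) [] ()
  zigzagShape (suc k) (_ ∷ []) ()

  -- classWords bs lists the braid class of zigzag a bs, each word once: the
  -- triple a b a at the front is either kept or flipped to b a b.  After a flip
  -- the shared letter is frozen, so the rest is a word of pinnedWords b bs,
  -- the class of zigzag a bs with its first letter replaced by b and never moved.
  module _ (a : Fin n) where

    mutual
      classWords : List (Fin n) → List (Word n)
      classWords [] = (a ∷ []) ∷ []
      classWords (b ∷ bs) = map (cons₂ a b) (classWords bs) ++ map (cons₂ b a) (pinnedWords b bs)

      pinnedWords : Fin n → List (Fin n) → List (Word n)
      pinnedWords c [] = (c ∷ []) ∷ []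
      pinnedWords c (b ∷ bs) = map (cons₂ c b) (classWords bs)

    mutual
      length-classWords : ∀ bs → length (classWords bs) ≡ F (2 + length bs)
      length-classWords [] = refl
      length-classWords (b ∷ bs) = begin
        length (map (cons₂ a b) (classWords bs) ++ map (cons₂ b a) (pinnedWords b bs))
          ≡⟨ length-++ (map (cons₂ a b) (classWords bs)) ⟩
        length (map (cons₂ a b) (classWords bs)) + length (map (cons₂ b a) (pinnedWords b bs))
          ≡⟨ cong₂ _+_ (length-map _ (classWords bs)) (length-map _ (pinnedWords b bs)) ⟩
        length (classWords bs) + length (pinnedWords b bs)
          ≡⟨ cong₂ _+_ (length-classWords bs) (length-pinnedWords b bs) ⟩
        F (2 + length bs) + F (1 + length bs)
          ∎
        where open ≡-Reasoning

      length-pinnedWords : ∀ c bs → length (pinnedWords c bs) ≡ F (1 + length bs)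
      length-pinnedWords c [] = refl
      length-pinnedWords c (b ∷ bs) = trans (length-map _ (classWords bs)) (length-classWords bs)

    mutual
      classWords-unique : ∀ {bs} → BraidsWith a bs → Unique (classWords bs)
      classWords-unique {[]} _ = [] ∷ []
      classWords-unique {b ∷ bs} (ab ∷ braids) =
        Unique.++⁺ (Unique.map⁺ cons₂-injective (classWords-unique braids))
                   (Unique.map⁺ cons₂-injective (pinnedWords-unique braids))
                   kept∩flipped≡∅
        where
        kept∩flipped≡∅ : Disjoint (map (cons₂ a b) (classWords bs)) (map (cons₂ b a) (pinnedWords b bs))
        kept∩flipped≡∅ (w∈kept , w∈flipped)
          with _ , _ , refl ← ∈-map⁻ (cons₂ a b) w∈kept
          with _ , _ , eq ← ∈-map⁻ (cons₂ b a) w∈flipped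
          = m≡3⇒≢ ab (∷-injectiveˡ eq)

      pinnedWords-unique : ∀ {c bs} → BraidsWith a bs → Unique (pinnedWords c bs)
      pinnedWords-unique {bs = []} _ = [] ∷ []
      pinnedWords-unique {bs = _ ∷ _} (_ ∷ braids) = Unique.map⁺ cons₂-injective (classWords-unique braids)

    zigzag∈classWords : ∀ bs → zigzag a bs ∈ classWords bs
    zigzag∈classWords [] = here refl
    zigzag∈classWords (b ∷ bs) = ∈-++⁺ˡ (∈-map⁺ (cons₂ a b) (zigzag∈classWords bs))

    mutual
      classWords-reachable : ∀ {bs w} → BraidsWith a bs → w ∈ classWords bs → InBraidClass M (zigzag a bs) w
      classWords-reachable {[]} _ (here refl) = ε
      classWords-reachable {[]} _ (there ())
      classWords-reachable {b ∷ bs} (ab ∷ braids) w∈ with ∈-++⁻ (map (cons₂ a b) (classWords bs)) w∈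
      ... | inj₁ w∈kept with _ , w′∈ , refl ← ∈-map⁻ (cons₂ a b) w∈kept =
        ∷-braids a (∷-braids b (classWords-reachable braids w′∈))
      ... | inj₂ w∈flipped with _ , w′∈ , refl ← ∈-map⁻ (cons₂ b a) w∈flipped =
        move [] a b (zigzagTail a bs) ab ◅ ∷-braids b (∷-braids a (pinnedWords-reachable braids w′∈))

      pinnedWords-reachable : ∀ {c bs w} → BraidsWith a bs → w ∈ pinnedWords c bs →
                              InBraidClass M (c ∷ zigzagTail a bs) w
      pinnedWords-reachable {bs = []} _ (here refl) = ε
      pinnedWords-reachable {bs = []} _ (there ())
      pinnedWords-reachable {c} {b ∷ bs} (_ ∷ braids) w∈ with _ , w′∈ , refl ← ∈-map⁻ (cons₂ c b) w∈ =
        ∷-braids c (∷-braids b (classWords-reachable braids w′∈))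

    a∷∈classWords⇒∈pinnedWords : ∀ {bs v} c → BraidsWith a bs → a ∷ v ∈ classWords bs → c ∷ v ∈ pinnedWords c bs
    a∷∈classWords⇒∈pinnedWords {[]} c _ (here refl) = here refl
    a∷∈classWords⇒∈pinnedWords {[]} c _ (there ())
    a∷∈classWords⇒∈pinnedWords {b ∷ bs} c (ab ∷ _) v∈ with ∈-++⁻ (map (cons₂ a b) (classWords bs)) v∈
    ... | inj₁ v∈kept with _ , w∈ , refl ← ∈-map⁻ (cons₂ a b) v∈kept = ∈-map⁺ (cons₂ c b) w∈
    ... | inj₂ v∈flipped with _ , _ , eq ← ∈-map⁻ (cons₂ b a) v∈flipped = ⊥-elim (m≡3⇒≢ ab (∷-injectiveˡ eq))

    c∷∈pinnedWords⇒a∷∈classWords : ∀ {c bs v} → c ∷ v ∈ pinnedWords c bs → a ∷ v ∈ classWords bs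
    c∷∈pinnedWords⇒a∷∈classWords {bs = []} (here refl) = here refl
    c∷∈pinnedWords⇒a∷∈classWords {bs = []} (there ())
    c∷∈pinnedWords⇒a∷∈classWords {c} {b ∷ bs} v∈ with _ , w∈ , refl ← ∈-map⁻ (cons₂ c b) v∈ =
      ∈-++⁺ˡ (∈-map⁺ (cons₂ a b) w∈)

    mutual
      classWords-braidMove : TriangleFree M → ∀ {bs u s t v} → BraidsWith a bs → EvenLength u →
                             m M s t ≡ fin 3 → u ++ s ∷ t ∷ s ∷ v ∈ classWords bs →
                             u ++ t ∷ s ∷ t ∷ v ∈ classWords bs
      classWords-braidMove _ {[]} _ even-[] _ (here ())
      classWords-braidMove _ {[]} _ (even-∷∷ _) _ (here ())
      classWords-braidMove _ {[]} _ _ _ (there ())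
      classWords-braidMove tf {b ∷ bs} (ab ∷ braids) even st w∈ with ∈-++⁻ (map (cons₂ a b) (classWords bs)) w∈
      classWords-braidMove tf {b ∷ bs} (ab ∷ braids) even-[] st w∈ | inj₁ w∈kept
        with _ , w′∈ , refl ← ∈-map⁻ (cons₂ a b) w∈kept =
        ∈-++⁺ʳ (map (cons₂ a b) (classWords bs)) (∈-map⁺ (cons₂ b a) (a∷∈classWords⇒∈pinnedWords b braids w′∈))
      classWords-braidMove tf {b ∷ bs} (ab ∷ braids) even-[] st w∈ | inj₂ w∈flipped
        with _ , w′∈ , refl ← ∈-map⁻ (cons₂ b a) w∈flipped =
        ∈-++⁺ˡ (∈-map⁺ (cons₂ a b) (c∷∈pinnedWords⇒a∷∈classWords {bs = bs} w′∈))
      classWords-braidMove tf {b ∷ bs} (ab ∷ braids) (even-∷∷ even) st w∈ | inj₁ w∈kept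
        with _ , w′∈ , refl ← ∈-map⁻ (cons₂ a b) w∈kept =
        ∈-++⁺ˡ (∈-map⁺ (cons₂ a b) (classWords-braidMove tf braids even st w′∈))
      classWords-braidMove tf {b ∷ bs} (ab ∷ braids) (even-∷∷ even) st w∈ | inj₂ w∈flipped
        with _ , w′∈ , refl ← ∈-map⁻ (cons₂ b a) w∈flipped =
        ∈-++⁺ʳ (map (cons₂ a b) (classWords bs))
          (∈-map⁺ (cons₂ b a) (pinnedWords-braidMove tf (ab ∷ braids) even st w′∈))

      pinnedWords-braidMove : TriangleFree M → ∀ {c bs u s t v} → BraidsWith a (c ∷ bs) → EvenLength u →
                              m M s t ≡ fin 3 → u ++ s ∷ t ∷ s ∷ v ∈ pinnedWords c bs →
                              u ++ t ∷ s ∷ t ∷ v ∈ pinnedWords c bs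
      pinnedWords-braidMove _ {bs = []} _ even-[] _ (here ())
      pinnedWords-braidMove _ {bs = []} _ (even-∷∷ _) _ (here ())
      pinnedWords-braidMove _ {bs = []} _ _ _ (there ())
      -- A move on c b c here needs both neighbouring triples flipped; then a, c, b is a triangle.
      pinnedWords-braidMove tf {c} {b ∷ bs} (ac ∷ ab ∷ _) even-[] cb w∈
        with _ , _ , refl ← ∈-map⁻ (cons₂ c b) w∈ =
        ⊥-elim (tf a c b (m≡3⇒Edge ac , m≡3⇒Edge cb , m≡3⇒Edge (trans (CoxeterMatrix.sym M b a) ab)))
      pinnedWords-braidMove tf {c} {b ∷ bs} (_ ∷ _ ∷ braids) (even-∷∷ even) st w∈
        with _ , w′∈ , refl ← ∈-map⁻ (cons₂ c b) w∈ =
        ∈-map⁺ (cons₂ c b) (classWords-braidMove tf braids even st w′∈)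

    classWords-closed : TriangleFree M → ∀ {bs x y} → BraidsWith a bs →
                        (∀ i → InBsClass M x i → Even M i) → x ∈ classWords bs →
                        InBraidClass M x y → y ∈ classWords bs
    classWords-closed _ _ _ x∈ ε = x∈
    classWords-closed tf braids shadowsEven x∈ (move u s t v st ◅ x′→y) =
      classWords-closed tf braids
        (λ i (z , x′→z , shadow) → shadowsEven i (z , move u s t v st ◅ x′→z , shadow))
        (classWords-braidMove tf braids
          (Even⇒EvenLength u (shadowsEven (length u) (_ , ε , u , s , t , v , refl , refl , st))) st x∈)
        x′→y

    zigzag-braidClassSize : TriangleFree M → ∀ {bs} → BraidsWith a bs →
                            (∀ i → InBsClass M (zigzag a bs) i → Even M i) →
                            BraidClassSize M (zigzag a bs) (F (2 + length bs))
    zigzag-braidClassSize tf {bs} braids shadowsEven =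
      classWords bs , classWords-unique braids ,
      (λ w → mk⇔ (classWords-reachable braids)
                 (classWords-closed tf braids shadowsEven (zigzag∈classWords bs))) ,
      length-classWords bs

  fibonacciLink-evenShadows : ∀ {φ} → IsFibonacciLink M φ →
    ∃ λ k → length φ ≡ suc (k + k) × (∀ i → InBsClass M φ i ⇔ (Even M i × i + 3 ≤ length φ))
  fibonacciLink-evenShadows ((_ , _ , inj₂ ((k , length≡) , shadows⇔)) , _) = k , length≡ , shadows⇔
  fibonacciLink-evenShadows {φ} ((_ , _ , inj₁ length≡1) , classShadows⇔shadows) =
    0 , length≡1 , λ i → mk⇔ (⊥-elim ∘ tooShort i ∘ IsShadow⇒+3≤length ∘ to (classShadows⇔shadows i))
                             (⊥-elim ∘ tooShort i ∘ proj₂)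
    where
    tooShort : ∀ i → i + 3 ≤ length φ → ⊥
    tooShort i = ¬i+3≤1 i ∘ subst (i + 3 ≤_) length≡1

  rank≡ : ∀ {φ k r} → length φ ≡ suc (k + k) →
          (∀ i → InBsClass M φ i ⇔ (Even M i × i + 3 ≤ length φ)) → HasRank M φ r → r ≡ k
  rank≡ {φ} {k} length≡ shadows⇔ (L , L! , L⇔ , refl) =
    trans (unique∧set⇒length≡ L! (evenStarts-unique k) L⇔evenStarts) (length-applyUpTo _ k)
    where
    L⇔evenStarts : ∀ i → i ∈ L ⇔ i ∈ evenStarts k
    L⇔evenStarts i =
      ⇔.trans (L⇔ i)
        (⇔.trans (subst (λ ℓ → InBsClass M φ i ⇔ (Even M i × i + 3 ≤ ℓ)) length≡ (shadows⇔ i))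
                 (⇔.sym ∈-evenStarts))

proposition6p9 : ∀ (n : ℕ) (M : CoxeterMatrix n) → SimplyLaced M → TriangleFree M →
    ∀ (φ : List (Fin n)) (r : ℕ) → IsFibonacciLink M φ → HasRank M φ r →
    BraidClassSize M φ (F (r + 2))
proposition6p9 n M _ triangleFree φ r fibonacci@(_ , classShadows⇔shadows) rank
  with k , length≡ , classShadows⇔evens ← fibonacciLink-evenShadows M fibonacci
  with a , bs , refl , refl , braids ←
         zigzagShape M k φ length≡
           (λ i even bound → to (classShadows⇔shadows i) (from (classShadows⇔evens i) (even , bound)))
  with refl ← rank≡ M {k = length bs} length≡ classShadows⇔evens rank
  = subst (BraidClassSize M φ) (cong F (+-comm 2 (length bs)))
      (zigzag-braidClassSize M a triangleFree braids (λ i → proj₁ ∘ to (classShadows⇔evens i)))
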